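{- Let $F:\mathbb{N}^+\times\mathbb{N}^+\to\mathbb{N}^+$ be defined by $$F(m,n)=\frac{1}{4}\left[(m+n-1)^2-\big((m+n-1)\bmod 2\big)\right]+\min(m,n).$$ Let $S_O=\{(x,y)\in\mathbb{N}^+\times\mathbb{N}^+ : x\ge y\}$. Then the restriction of $F$ to $S_O$ is an injection from $S_O$ to $\mathbb{N}^+$.
   Context: $\mathbb{N}^+$ denotes the set of positive integers. For an integer $k$, $k\bmod 2$ denotes the least non-negative residue of $k$ modulo $2$. In the paper, $S_O$ is regarded as an ordered set (pairs ordered first by increasing $x+y$, then by increasing $y$), but the ordering is irrelevant to this statement. -}

module Defs where

open import Data.Nat using (ℕ; _+_; _*_; _∸_; _⊓_)
open import Data.Nat.DivMod using (_/_; _%_)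

-- F(m,n) = ((m+n-1)^2 - ((m+n-1) mod 2)) / 4 + min(m,n), for m, n ≥ 1.
-- The numerator is always divisible by 4, so ℕ-division is exact here.
F : ℕ → ℕ → ℕ
F m n = let k = m + n ∸ 1 in (k * k ∸ k % 2) / 4 + (m ⊓ n)

-- Write k = m + n - 1 for the anti-diagonal through (m, n); the first term of F is
-- ⌊k²/4⌋, and on S_O the second term is y with 1 ≤ y ≤ ⌈k/2⌉ = ⌊(k+1)²/4⌋ - ⌊k²/4⌋.
-- So F maps the part of the k-th anti-diagonal lying in S_O injectively into the
-- interval (⌊k²/4⌋, ⌊(k+1)²/4⌋], and these intervals are pairwise disjoint.
module Submission where

open import Defs
open import Data.Nat using (ℕ; zero; suc; _+_; _*_; _∸_; _≤_; _≥_; _<_; _≤′_; ≤′-refl; ≤′-step; z≤n; s≤s; s≤s⁻¹)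
open import Data.Nat.Properties
open import Data.Nat.DivMod using (_/_; _%_; m*n%n≡0; [m+kn]%n≡m%n; m*n/n≡m)
open import Data.Nat.Tactic.RingSolver using (solve-∀)
open import Data.Product using (_×_; _,_)
open import Data.Empty using (⊥-elim)
open import Relation.Binary using (_Preserves_⟶_; tri<; tri≈; tri>)
open import Relation.Binary.PropositionalEquality

quarterSquare : ℕ → ℕ
quarterSquare k = (k * k ∸ k % 2) / 4

data ParityView : ℕ → Set where
  even : ∀ a → ParityView (a * 2)
  odd  : ∀ a → ParityView (1 + a * 2)

parityView : ∀ k → ParityView k
parityView zero = even 0
parityView (suc k) with parityView k
... | even a = odd a
... | odd a  = even (suc a)

quarterSquare-even : ∀ a → quarterSquare (a * 2) ≡ a * a
quarterSquare-even a = begin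
  (a * 2 * (a * 2) ∸ (a * 2) % 2) / 4  ≡⟨ cong (λ r → (a * 2 * (a * 2) ∸ r) / 4) (m*n%n≡0 a 2) ⟩
  (a * 2 * (a * 2)) / 4                ≡⟨ cong (_/ 4) (square a) ⟩
  (a * a * 4) / 4                      ≡⟨ m*n/n≡m (a * a) 4 ⟩
  a * a                                ∎
  where
  open ≡-Reasoning
  square : ∀ a → a * 2 * (a * 2) ≡ a * a * 4
  square = solve-∀

quarterSquare-odd : ∀ a → quarterSquare (1 + a * 2) ≡ a * a + a
quarterSquare-odd a = begin
  ((1 + a * 2) * (1 + a * 2) ∸ (1 + a * 2) % 2) / 4
    ≡⟨ cong (λ r → ((1 + a * 2) * (1 + a * 2) ∸ r) / 4) ([m+kn]%n≡m%n 1 a 2) ⟩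
  ((1 + a * 2) * (1 + a * 2) ∸ 1) / 4  ≡⟨ cong (λ s → (s ∸ 1) / 4) (square a) ⟩
  ((a * a + a) * 4) / 4                ≡⟨ m*n/n≡m (a * a + a) 4 ⟩
  a * a + a                            ∎
  where
  open ≡-Reasoning
  square : ∀ a → (1 + a * 2) * (1 + a * 2) ≡ 1 + (a * a + a) * 4
  square = solve-∀

quarterSquare-+-≤-suc : ∀ k y → y * 2 ≤ suc k → quarterSquare k + y ≤ quarterSquare (suc k)
quarterSquare-+-≤-suc k y y*2≤1+k with parityView k
... | even a rewrite quarterSquare-even a | quarterSquare-odd a =
  +-monoʳ-≤ (a * a) (s≤s⁻¹ (*-cancelʳ-< _ y (suc a) (s≤s y*2≤1+k)))
... | odd a rewrite quarterSquare-odd a | quarterSquare-even (suc a) = begin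
  a * a + a + y      ≤⟨ +-monoʳ-≤ (a * a + a) (*-cancelʳ-≤ y (suc a) 2 y*2≤1+k) ⟩
  a * a + a + suc a  ≡⟨ square a ⟩
  suc a * suc a      ∎
  where
  open ≤-Reasoning
  square : ∀ a → a * a + a + suc a ≡ suc a * suc a
  square = solve-∀

quarterSquare-mono-≤ : quarterSquare Preserves _≤_ ⟶ _≤_
quarterSquare-mono-≤ k≤k′ = mono (≤⇒≤′ k≤k′)
  where
  mono : ∀ {k k′} → k ≤′ k′ → quarterSquare k ≤ quarterSquare k′
  mono ≤′-refl = ≤-refl
  mono (≤′-step {k′} k≤′k′) =
    ≤-trans (mono k≤′k′) (≤-trans (m≤m+n _ 0) (quarterSquare-+-≤-suc k′ 0 z≤n))

block-index-unique : ∀ {f : ℕ → ℕ} → f Preserves _≤_ ⟶ _≤_ → ∀ {k k′ v} →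
                     f k < v → v ≤ f (suc k) → f k′ < v → v ≤ f (suc k′) → k ≡ k′
block-index-unique f-mono {k} {k′} fk<v v≤fk+1 fk′<v v≤fk′+1 with <-cmp k k′
... | tri< k<k′ _ _ = ⊥-elim (<⇒≱ fk′<v (≤-trans v≤fk+1 (f-mono k<k′)))
... | tri≈ _ k≡k′ _ = k≡k′
... | tri> _ _ k′<k = ⊥-elim (<⇒≱ fk<v (≤-trans v≤fk′+1 (f-mono k′<k)))

F-on-S_O : ∀ x y → y ≤ suc x → F (suc x) y ≡ quarterSquare (x + y) + y
F-on-S_O x y y≤1+x = cong (quarterSquare (x + y) +_) (m≥n⇒m⊓n≡n y≤1+x)

F-lower : ∀ x y → 1 ≤ y → y ≤ suc x → quarterSquare (x + y) < F (suc x) y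
F-lower x y 1≤y y≤1+x rewrite F-on-S_O x y y≤1+x =
  subst (_≤ quarterSquare (x + y) + y) (+-comm (quarterSquare (x + y)) 1) (+-monoʳ-≤ _ 1≤y)

F-upper : ∀ x y → y ≤ suc x → F (suc x) y ≤ quarterSquare (suc (x + y))
F-upper x y y≤1+x rewrite F-on-S_O x y y≤1+x =
  quarterSquare-+-≤-suc (x + y) y (begin
    y * 2        ≡⟨ *-comm y 2 ⟩
    y + (y + 0)  ≡⟨ cong (y +_) (+-identityʳ y) ⟩
    y + y        ≤⟨ +-monoʳ-≤ y y≤1+x ⟩
    y + suc x    ≡⟨ +-comm y (suc x) ⟩
    suc (x + y)  ∎)
  where open ≤-Reasoning

theorem1 : (∀ x y → 1 ≤ x → 1 ≤ y → x ≥ y → 1 ≤ F x y)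
    × (∀ x y x′ y′ → 1 ≤ x → 1 ≤ y → x ≥ y → 1 ≤ x′ → 1 ≤ y′ → x′ ≥ y′
         → F x y ≡ F x′ y′ → (x ≡ x′ × y ≡ y′))
theorem1 = positive , injective
  where
  positive : ∀ x y → 1 ≤ x → 1 ≤ y → x ≥ y → 1 ≤ F x y
  positive (suc x) y _ 1≤y y≤1+x = ≤-trans (s≤s z≤n) (F-lower x y 1≤y y≤1+x)

  injective : ∀ x y x′ y′ → 1 ≤ x → 1 ≤ y → x ≥ y → 1 ≤ x′ → 1 ≤ y′ → x′ ≥ y′
              → F x y ≡ F x′ y′ → (x ≡ x′ × y ≡ y′)
  injective (suc x) y (suc x′) y′ _ 1≤y y≤1+x _ 1≤y′ y′≤1+x′ Fxy≡Fx′y′ =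
    cong suc (+-cancelʳ-≡ y x x′ (trans same-diagonal (cong (x′ +_) (sym y≡y′)))) , y≡y′
    where
    same-diagonal : x + y ≡ x′ + y′
    same-diagonal = block-index-unique quarterSquare-mono-≤
      (F-lower x y 1≤y y≤1+x) (F-upper x y y≤1+x)
      (subst (quarterSquare (x′ + y′) <_) (sym Fxy≡Fx′y′) (F-lower x′ y′ 1≤y′ y′≤1+x′))
      (subst (_≤ quarterSquare (suc (x′ + y′))) (sym Fxy≡Fx′y′) (F-upper x′ y′ y′≤1+x′))

    y≡y′ : y ≡ y′
    y≡y′ = +-cancelˡ-≡ (quarterSquare (x + y)) y y′ (begin
      quarterSquare (x + y) + y     ≡⟨ F-on-S_O x y y≤1+x ⟨
      F (suc x) y                   ≡⟨ Fxy≡Fx′y′ ⟩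
      F (suc x′) y′                 ≡⟨ F-on-S_O x′ y′ y′≤1+x′ ⟩
      quarterSquare (x′ + y′) + y′  ≡⟨ cong (λ k → quarterSquare k + y′) same-diagonal ⟨
      quarterSquare (x + y) + y′    ∎)
      where open ≡-Reasoning
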